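{- Let $H$ be the directed acyclic graph with vertex set $\{a,b,c,e,k,f,g,h,i,j\}$ and arcs $a\to b$, $a\to c$, $b\to e$, $b\to k$, $c\to f$, $c\to g$, $e\to h$, $k\to h$, $f\to i$, $g\to i$, $h\to j$, $i\to j$. Let $N$ be any maximal matching of the underlying simple graph of $H$, and assign to each arc delay $d$ if its underlying edge lies in $N$ and delay $D$ otherwise, where $0\le d<D$. Then no directed path from $a$ to $j$ has delay $4D$, and at least one directed path from $a$ to $j$ has delay $d+3D$.
   Context: The delay of a directed path is the sum of the delays of its arcs (vertices have delay $0$). A matching is maximal if it is not contained in a larger matching. Assigning delays from a matching corresponds to clustering with capacity $2$ and unit vertex weights where matched pairs form clusters.
   Formalization: The delays $d$ and $D$ are rational numbers. -}

module Defs where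

open import Data.Bool using (Bool; true; false; if_then_else_)
open import Data.Product using (Σ; ∃; ∃-syntax; _×_; _,_)
open import Data.Sum using (_⊎_)
open import Relation.Binary.PropositionalEquality using (_≡_)
open import Relation.Nullary using (¬_)
open import Data.Rational using (ℚ; 0ℚ; _+_)

data V : Set where
  a b c e k f g h i j : V

data Arc : V → V → Set where
  ab : Arc a b
  ac : Arc a c
  be : Arc b e
  bk : Arc b k
  cf : Arc c f
  cg : Arc c g
  eh : Arc e h
  kh : Arc k h
  fi : Arc f i
  gi : Arc g i
  hj : Arc h j
  ij : Arc i j

Adj : V → V → Set
Adj u v = Arc u v ⊎ Arc v u

-- An edge set of the underlying simple graph is a symmetric Boolean
-- relation on vertices that only holds on adjacent pairs.
record IsMatching (N : V → V → Bool) : Set where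
  field
    sym-N   : ∀ u v → N u v ≡ N v u
    edges   : ∀ u v → N u v ≡ true → Adj u v
    disjoint : ∀ u v w → N u v ≡ true → N u w ≡ true → v ≡ w

_⊆E_ : (V → V → Bool) → (V → V → Bool) → Set
N ⊆E N' = ∀ u v → N u v ≡ true → N' u v ≡ true

_⊂E_ : (V → V → Bool) → (V → V → Bool) → Set
N ⊂E N' = N ⊆E N' × ∃[ u ] ∃[ v ] (N' u v ≡ true × N u v ≡ false)

record IsMaximalMatching (N : V → V → Bool) : Set where
  field
    matching : IsMatching N
    maximal  : ¬ (Σ (V → V → Bool) λ N' → IsMatching N' × N ⊂E N')

data Path : V → V → Set where
  [] : ∀ {u} → Path u u
  _∷_ : ∀ {u v w} → Arc u v → Path v w → Path u w

arcDelay : (N : V → V → Bool) (d D : ℚ) {u v : V} → Arc u v → ℚ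
arcDelay N d D {u} {v} _ = if N u v then d else D

delay : (N : V → V → Bool) (d D : ℚ) {u v : V} → Path u v → ℚ
delay N d D [] = 0ℚ
delay N d D (x ∷ p) = arcDelay N d D x + delay N d D p

module Submission where

-- H is the union of two diamonds a → y → {z, z'} → w → j, namely
-- a → b → {e, k} → h → j and a → c → {f, g} → i → j, and its four a→j paths
-- are the two sides of each diamond.  The proof combines three ingredients.
--   * Maximal matchings: no edge has two free endpoints, since adding it would
--     give a larger matching (addEdge-matching, no-free-edge).
--   * Diamonds: if a side a → y → z → w → j were entirely unmatched, z would be
--     free, forcing both y and w to be matched to z', which is impossible; so
--     every route carries a matched arc.  If a–y is unmatched, a case analysis
--     on w–j and y–z yields a side with exactly one matched arc.
--   * Delays: a path with a matched arc is faster than (number of arcs)·D, and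
--     one with exactly one matched arc has delay d + (number of arcs − 1)·D.
-- As a is matched at most once, a–b or a–c is unmatched, and lemma2 follows.

open import Defs
open import Data.Bool using (Bool; true; false; _∨_)
open import Data.Bool.Properties using (∨-zeroʳ)
open import Data.Nat using (ℕ)
import Data.Nat.Properties as ℕ
open import Data.Product using (_×_; _,_; ∃-syntax)
open import Data.Sum using (_⊎_; inj₁; inj₂; [_,_]; map₂; swap)
open import Data.Empty using (⊥; ⊥-elim)
open import Function using (_∘_)
open import Function.Bundles using (mk⇔)
open import Relation.Binary.PropositionalEquality
  using (_≡_; _≢_; refl; sym; trans; cong; cong₂; subst; module ≡-Reasoning)
open import Relation.Nullary using (¬_; Dec; yes; does)
open import Relation.Nullary.Decidable using (map′; does-⇔; dec-true; _×-dec_; _⊎-dec_)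
open import Data.Rational using (ℚ; 0ℚ; _+_; _≤_; _<_)
open import Data.Rational.Properties
  using (+-assoc; +-identityʳ; ≤-refl; <⇒≤; <⇒≢; +-mono-≤; +-mono-<-≤; +-mono-≤-<; +-0-commutativeMonoid)
open import Algebra.Bundles using (CommutativeMonoid)
open import Algebra.Properties.CommutativeSemigroup
  (CommutativeMonoid.commutativeSemigroup +-0-commutativeMonoid) using (x∙yz≈y∙xz)

private
  variable
    N : V → V → Bool
    s t u v w x y z z' : V

-- Decidable equality of vertices, inherited from ℕ through an injective
-- numbering; it is needed to add a single edge to a matching.

vertexIndex : V → ℕ
vertexIndex a = 0
vertexIndex b = 1
vertexIndex c = 2
vertexIndex e = 3
vertexIndex k = 4
vertexIndex f = 5
vertexIndex g = 6
vertexIndex h = 7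
vertexIndex i = 8
vertexIndex j = 9

vertexOf : ℕ → V
vertexOf 0 = a
vertexOf 1 = b
vertexOf 2 = c
vertexOf 3 = e
vertexOf 4 = k
vertexOf 5 = f
vertexOf 6 = g
vertexOf 7 = h
vertexOf 8 = i
vertexOf _ = j

vertexOf-index : ∀ v → vertexOf (vertexIndex v) ≡ v
vertexOf-index a = refl
vertexOf-index b = refl
vertexOf-index c = refl
vertexOf-index e = refl
vertexOf-index k = refl
vertexOf-index f = refl
vertexOf-index g = refl
vertexOf-index h = refl
vertexOf-index i = refl
vertexOf-index j = refl

vertexIndex-injective : vertexIndex u ≡ vertexIndex v → u ≡ v
vertexIndex-injective {u} {v} eq =
  trans (sym (vertexOf-index u)) (trans (cong vertexOf eq) (vertexOf-index v))

_≟_ : (u v : V) → Dec (u ≡ v)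
u ≟ v = map′ vertexIndex-injective (cong vertexIndex) (vertexIndex u ℕ.≟ vertexIndex v)

∨-true : ∀ p {q} → p ∨ q ≡ true → p ≡ true ⊎ q ≡ true
∨-true true _ = inj₁ refl
∨-true false q = inj₂ q

does-sound : {P : Set} (P? : Dec P) → does P? ≡ true → P
does-sound (yes p) _ = p

adj-irreflexive : ¬ Adj u u
adj-irreflexive (inj₁ ())
adj-irreflexive (inj₂ ())

adj-sym : Adj u v → Adj v u
adj-sym (inj₁ uv) = inj₂ uv
adj-sym (inj₂ vu) = inj₁ vu

Free : (V → V → Bool) → V → Set
Free N u = ∀ w → N u w ≡ false

IsPair : V → V → V → V → Set
IsPair u v x y = (x ≡ u × y ≡ v) ⊎ (x ≡ v × y ≡ u)

isPair? : ∀ u v x y → Dec (IsPair u v x y)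
isPair? u v x y = ((x ≟ u) ×-dec (y ≟ v)) ⊎-dec ((x ≟ v) ×-dec (y ≟ u))

isPair-sym : IsPair u v x y → IsPair u v y x
isPair-sym (inj₁ (p , q)) = inj₂ (q , p)
isPair-sym (inj₂ (p , q)) = inj₁ (q , p)

addEdge : (V → V → Bool) → V → V → (V → V → Bool)
addEdge N u v x y = N x y ∨ does (isPair? u v x y)

addEdge-cases : ∀ N u v x y → addEdge N u v x y ≡ true → N x y ≡ true ⊎ IsPair u v x y
addEdge-cases N u v x y on with ∨-true (N x y) on
... | inj₁ old = inj₁ old
... | inj₂ new = inj₂ (does-sound (isPair? u v x y) new)

addEdge-matching : IsMatching N → Adj u v → Free N u → Free N v →
                   IsMatching (addEdge N u v)
addEdge-matching {N} {u} {v} M uv free-u free-v = record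
  { sym-N = λ x y → cong₂ _∨_ (sym-N x y)
                      (does-⇔ (mk⇔ isPair-sym isPair-sym) (isPair? u v x y) (isPair? u v y x))
  ; edges = edges′
  ; disjoint = disjoint′
  }
  where
  open IsMatching M

  edges′ : ∀ x y → addEdge N u v x y ≡ true → Adj x y
  edges′ x y on with addEdge-cases N u v x y on
  ... | inj₁ old = edges x y old
  ... | inj₂ (inj₁ (refl , refl)) = uv
  ... | inj₂ (inj₂ (refl , refl)) = adj-sym uv

  covered : ∀ {x y} → N x y ≡ true → x ≡ u ⊎ x ≡ v → ⊥
  covered {x} {y} on (inj₁ refl) with () ← trans (sym on) (free-u y)
  covered {x} {y} on (inj₂ refl) with () ← trans (sym on) (free-v y)

  disjoint′ : ∀ x y y' → addEdge N u v x y ≡ true → addEdge N u v x y' ≡ true → y ≡ y'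
  disjoint′ x y y' on on' with addEdge-cases N u v x y on | addEdge-cases N u v x y' on'
  ... | inj₁ old | inj₁ old'              = disjoint x y y' old old'
  ... | inj₁ old | inj₂ (inj₁ (x≡u , _))  = ⊥-elim (covered old (inj₁ x≡u))
  ... | inj₁ old | inj₂ (inj₂ (x≡v , _))  = ⊥-elim (covered old (inj₂ x≡v))
  ... | inj₂ (inj₁ (x≡u , _)) | inj₁ old' = ⊥-elim (covered old' (inj₁ x≡u))
  ... | inj₂ (inj₂ (x≡v , _)) | inj₁ old' = ⊥-elim (covered old' (inj₂ x≡v))
  ... | inj₂ (inj₁ (_ , refl)) | inj₂ (inj₁ (_ , refl)) = refl
  ... | inj₂ (inj₂ (_ , refl)) | inj₂ (inj₂ (_ , refl)) = refl
  ... | inj₂ (inj₁ (refl , _)) | inj₂ (inj₂ (u≡v , _)) =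
          ⊥-elim (adj-irreflexive (subst (λ t → Adj t v) u≡v uv))
  ... | inj₂ (inj₂ (refl , _)) | inj₂ (inj₁ (v≡u , _)) =
          ⊥-elim (adj-irreflexive (subst (λ t → Adj t v) (sym v≡u) uv))

no-free-edge : IsMaximalMatching N → Adj u v → Free N u → Free N v → ⊥
no-free-edge {N} {u} {v} max uv free-u free-v =
  maximal (addEdge N u v , addEdge-matching matching uv free-u free-v ,
           extends , u , v , new-edge , free-u v)
  where
  open IsMaximalMatching max

  extends : N ⊆E addEdge N u v
  extends x y on = cong (_∨ does (isPair? u v x y)) on

  new-edge : addEdge N u v u v ≡ true
  new-edge = trans (cong (N u v ∨_) (dec-true (isPair? u v u v) (inj₁ (refl , refl))))
                   (∨-zeroʳ (N u v))

free-if-unmatched : IsMatching N → (∀ {w} → Adj u w → N u w ≡ false) → Free N u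
free-if-unmatched {N} {u} M unmatched w with N u w in on
... | false = refl
... | true  = trans (sym on) (unmatched (IsMatching.edges M u w on))

forced-partner : IsMaximalMatching N → Adj u v → Free N v →
                 (∀ {w} → Adj u w → N u w ≡ false ⊎ w ≡ x) → N u x ≡ true
forced-partner {N} {u} {v} {x} max uv free-v others with N u x in off
... | true  = refl
... | false = ⊥-elim (no-free-edge max uv (free-if-unmatched matching unmatched) free-v)
  where
  open IsMaximalMatching max

  unmatched : ∀ {w} → Adj u w → N u w ≡ false
  unmatched uw with others uw
  ... | inj₁ u-w-off = u-w-off
  ... | inj₂ refl    = off

partner-unique : IsMatching N → N u v ≡ true → w ≢ v → N u w ≡ false
partner-unique {N} {u} {v} {w} M u-v-on w≢v with N u w in on
... | false = refl
... | true  = ⊥-elim (w≢v (IsMatching.disjoint M u w v on u-v-on))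

data SomeMatched (N : V → V → Bool) : Path u v → Set where
  here  : {x : Arc u v} {p : Path v w} → N u v ≡ true → SomeMatched N (x ∷ p)
  there : {x : Arc u v} {p : Path v w} → SomeMatched N p → SomeMatched N (x ∷ p)

infixr 5 _∷_

data NoneMatched (N : V → V → Bool) : Path u v → Set where
  []  : NoneMatched N ([] {u})
  _∷_ : {x : Arc u v} {p : Path v w} → N u v ≡ false → NoneMatched N p →
        NoneMatched N (x ∷ p)

data OneMatched (N : V → V → Bool) : Path u v → Set where
  here  : {x : Arc u v} {p : Path v w} → N u v ≡ true → NoneMatched N p →
          OneMatched N (x ∷ p)
  there : {x : Arc u v} {p : Path v w} → N u v ≡ false → OneMatched N p →
          OneMatched N (x ∷ p)

some-or-none : (p : Path u v) → SomeMatched N p ⊎ NoneMatched N p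
some-or-none [] = inj₂ []
some-or-none {u} {N = N} (_∷_ {v = v} x p) with N u v in on | some-or-none {N = N} p
... | true  | _         = inj₁ (here on)
... | false | inj₁ some = inj₁ (there some)
... | false | inj₂ none = inj₂ (on ∷ none)

fullDelay : ℚ → Path u v → ℚ
fullDelay D []      = 0ℚ
fullDelay D (_ ∷ p) = D + fullDelay D p

module Delays (N : V → V → Bool) (d D : ℚ) where

  arcDelay-matched : (x : Arc u v) → N u v ≡ true → arcDelay N d D x ≡ d
  arcDelay-matched _ on rewrite on = refl

  arcDelay-unmatched : (x : Arc u v) → N u v ≡ false → arcDelay N d D x ≡ D
  arcDelay-unmatched _ off rewrite off = refl

  arcDelay-≤ : d ≤ D → (x : Arc u v) → arcDelay N d D x ≤ D
  arcDelay-≤ {u} {v} d≤D x with N u v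
  ... | true  = d≤D
  ... | false = ≤-refl

  delay-≤ : d ≤ D → (p : Path u v) → delay N d D p ≤ fullDelay D p
  delay-≤ d≤D []      = ≤-refl
  delay-≤ d≤D (x ∷ p) = +-mono-≤ (arcDelay-≤ d≤D x) (delay-≤ d≤D p)

  delay-< : d < D → {p : Path u v} → SomeMatched N p → delay N d D p < fullDelay D p
  delay-< d<D (here {x = x} {p} on) =
    +-mono-<-≤ (subst (_< D) (sym (arcDelay-matched x on)) d<D) (delay-≤ (<⇒≤ d<D) p)
  delay-< d<D (there {x = x} some) = +-mono-≤-< (arcDelay-≤ (<⇒≤ d<D) x) (delay-< d<D some)

  delay-none : {p : Path u v} → NoneMatched N p → delay N d D p ≡ fullDelay D p
  delay-none []                     = refl
  delay-none (_∷_ {x = x} off none) = cong₂ _+_ (arcDelay-unmatched x off) (delay-none none)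

  delay-one : {x : Arc u v} {p : Path v w} → OneMatched N (x ∷ p) →
              delay N d D (x ∷ p) ≡ d + fullDelay D p
  delay-one {x = x} (here on none) = cong₂ _+_ (arcDelay-matched x on) (delay-none none)
  delay-one {x = x} (there {p = y ∷ p} off one) = begin
    arcDelay N d D x + delay N d D (y ∷ p) ≡⟨ cong₂ _+_ (arcDelay-unmatched x off) (delay-one one) ⟩
    D + (d + fullDelay D p)                ≡⟨ x∙yz≈y∙xz D d (fullDelay D p) ⟩
    d + (D + fullDelay D p)                ∎
    where open ≡-Reasoning

sum-of-four : ∀ p q r s → p + (q + (r + (s + 0ℚ))) ≡ p + q + r + s
sum-of-four p q r s = begin
  p + (q + (r + (s + 0ℚ))) ≡⟨ cong (λ t → p + (q + (r + t))) (+-identityʳ s) ⟩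
  p + (q + (r + s))        ≡⟨ sym (+-assoc p q (r + s)) ⟩
  p + q + (r + s)          ≡⟨ sym (+-assoc (p + q) r s) ⟩
  p + q + r + s            ∎
  where open ≡-Reasoning

record Diamond (s y z z' w t : V) : Set where
  field
    sy  : Arc s y
    yz  : Arc y z
    yz' : Arc y z'
    zw  : Arc z w
    z'w : Arc z' w
    wt  : Arc w t
    around-y  : ∀ {v} → Adj y v → v ≡ s ⊎ v ≡ z ⊎ v ≡ z'
    around-z  : ∀ {v} → Adj z v → v ≡ y ⊎ v ≡ w
    around-z' : ∀ {v} → Adj z' v → v ≡ y ⊎ v ≡ w
    around-w  : ∀ {v} → Adj w v → v ≡ z ⊎ v ≡ z' ⊎ v ≡ t
    y≢w  : y ≢ w
    z≢z' : z ≢ z'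
    z≢t  : z ≢ t
    z'≢t : z' ≢ t

route : Diamond s y z z' w t → Path s t
route Δ = sy ∷ yz ∷ zw ∷ wt ∷ []
  where open Diamond Δ

mirror : Diamond s y z z' w t → Diamond s y z' z w t
mirror Δ = record
  { sy = sy ; yz = yz' ; yz' = yz ; zw = z'w ; z'w = zw ; wt = wt
  ; around-y  = λ yv → map₂ swap (around-y yv)
  ; around-z  = around-z'
  ; around-z' = around-z
  ; around-w  = λ wv → [ inj₂ ∘ inj₁ , map₂ inj₂ ] (around-w wv)
  ; y≢w = y≢w ; z≢z' = z≢z' ∘ sym ; z≢t = z'≢t ; z'≢t = z≢t
  }
  where open Diamond Δ

upper : Diamond a b e k h j
upper = record
  { sy = ab ; yz = be ; yz' = bk ; zw = eh ; z'w = kh ; wt = hj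
  ; around-y  = λ { (inj₂ ab) → inj₁ refl ; (inj₁ be) → inj₂ (inj₁ refl) ; (inj₁ bk) → inj₂ (inj₂ refl) }
  ; around-z  = λ { (inj₂ be) → inj₁ refl ; (inj₁ eh) → inj₂ refl }
  ; around-z' = λ { (inj₂ bk) → inj₁ refl ; (inj₁ kh) → inj₂ refl }
  ; around-w  = λ { (inj₂ eh) → inj₁ refl ; (inj₂ kh) → inj₂ (inj₁ refl) ; (inj₁ hj) → inj₂ (inj₂ refl) }
  ; y≢w = λ () ; z≢z' = λ () ; z≢t = λ () ; z'≢t = λ ()
  }

lower : Diamond a c f g i j
lower = record
  { sy = ac ; yz = cf ; yz' = cg ; zw = fi ; z'w = gi ; wt = ij
  ; around-y  = λ { (inj₂ ac) → inj₁ refl ; (inj₁ cf) → inj₂ (inj₁ refl) ; (inj₁ cg) → inj₂ (inj₂ refl) }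
  ; around-z  = λ { (inj₂ cf) → inj₁ refl ; (inj₁ fi) → inj₂ refl }
  ; around-z' = λ { (inj₂ cg) → inj₁ refl ; (inj₁ gi) → inj₂ refl }
  ; around-w  = λ { (inj₂ fi) → inj₁ refl ; (inj₂ gi) → inj₂ (inj₁ refl) ; (inj₁ ij) → inj₂ (inj₂ refl) }
  ; y≢w = λ () ; z≢z' = λ () ; z≢t = λ () ; z'≢t = λ ()
  }

module _ {N : V → V → Bool} {s y z z' w t : V}
         (max : IsMaximalMatching N) (Δ : Diamond s y z z' w t) where

  open Diamond Δ
  open IsMaximalMatching max
  open IsMatching matching

  -- No side of Δ is entirely unmatched: otherwise z is free, so y and w are
  -- matched, and the only partner left for both of them is z'.

  side-not-unmatched : N s y ≡ false → N y z ≡ false → N z w ≡ false → N w t ≡ false → ⊥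
  side-not-unmatched off-sy off-yz off-zw off-wt =
    y≢w (disjoint z' y w (trans (sym-N z' y) y-to-z') (trans (sym-N z' w) w-to-z'))
    where
    z-unmatched : ∀ {v} → Adj z v → N z v ≡ false
    z-unmatched zv with around-z zv
    ... | inj₁ refl = trans (sym-N z y) off-yz
    ... | inj₂ refl = off-zw

    z-free : Free N z
    z-free = free-if-unmatched matching z-unmatched

    y-others : ∀ {v} → Adj y v → N y v ≡ false ⊎ v ≡ z'
    y-others yv with around-y yv
    ... | inj₁ refl        = inj₁ (trans (sym-N y s) off-sy)
    ... | inj₂ (inj₁ refl) = inj₁ off-yz
    ... | inj₂ (inj₂ refl) = inj₂ refl

    w-others : ∀ {v} → Adj w v → N w v ≡ false ⊎ v ≡ z'
    w-others wv with around-w wv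
    ... | inj₁ refl        = inj₁ (trans (sym-N w z) off-zw)
    ... | inj₂ (inj₁ refl) = inj₂ refl
    ... | inj₂ (inj₂ refl) = inj₁ off-wt

    y-to-z' : N y z' ≡ true
    y-to-z' = forced-partner max (inj₁ yz) z-free y-others

    w-to-z' : N w z' ≡ true
    w-to-z' = forced-partner max (inj₂ zw) z-free w-others

  route-matched : SomeMatched N (route Δ)
  route-matched with some-or-none {N = N} (route Δ)
  ... | inj₁ some = some
  ... | inj₂ (off-sy ∷ off-yz ∷ off-zw ∷ off-wt ∷ []) =
          ⊥-elim (side-not-unmatched off-sy off-yz off-zw off-wt)

  -- If s–y is unmatched and w–t is matched, then z–w and z'–w are unmatched,
  -- and the side whose edge at y is unmatched has w–t as its only matched arc.

  one-matched-if-exit-matched : N s y ≡ false → N w t ≡ true →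
                                OneMatched N (route Δ) ⊎ OneMatched N (route (mirror Δ))
  one-matched-if-exit-matched off-sy on-wt with N y z in yz-state
  ... | false = inj₁ (there off-sy (there yz-state (there off-zw (here on-wt []))))
    where
    off-zw : N z w ≡ false
    off-zw = trans (sym-N z w) (partner-unique matching on-wt z≢t)
  ... | true  = inj₂ (there off-sy (there off-yz' (there off-z'w (here on-wt []))))
    where
    off-yz' : N y z' ≡ false
    off-yz' = partner-unique matching yz-state (z≢z' ∘ sym)
    off-z'w : N z' w ≡ false
    off-z'w = trans (sym-N z' w) (partner-unique matching on-wt z'≢t)

  -- If s–y and w–t are both unmatched, the side through z has exactly one
  -- matched arc: at least one by side-not-unmatched, at most one because y–z
  -- and z–w share z.

  one-matched-if-exit-free : N s y ≡ false → N w t ≡ false → OneMatched N (route Δ)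
  one-matched-if-exit-free off-sy off-wt with N y z in yz-state
  ... | true = there off-sy (here yz-state (off-zw ∷ off-wt ∷ []))
    where
    off-zw : N z w ≡ false
    off-zw = partner-unique matching (trans (sym-N z y) yz-state) (y≢w ∘ sym)
  ... | false with N z w in zw-state
  ...   | true  = there off-sy (there yz-state (here zw-state (off-wt ∷ [])))
  ...   | false = ⊥-elim (side-not-unmatched off-sy yz-state zw-state off-wt)

  route-one-matched : N s y ≡ false → OneMatched N (route Δ) ⊎ OneMatched N (route (mirror Δ))
  route-one-matched off-sy with N w t in wt-state
  ... | true  = one-matched-if-exit-matched off-sy wt-state
  ... | false = inj₁ (one-matched-if-exit-free off-sy wt-state)

-- Every a→j path is a route of upper, lower or one of their
-- mirrors, so it contains a matched arc and is faster than 4D.  The edge a–b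
-- or the edge a–c is unmatched, so upper or lower provides a route with
-- exactly one matched arc, whose delay is d + 3D.

lemma2 : (N : V → V → Bool) → IsMaximalMatching N →
         (d D : ℚ) → 0ℚ ≤ d → d < D →
         ((p : Path a j) → ¬ (delay N d D p ≡ D + D + D + D))
         × (∃[ p ] (delay N d D {a} {j} p ≡ d + D + D + D))
lemma2 N max d D _ d<D = never-four-D , one-matched-route
  where
  open Delays N d D
  open IsMaximalMatching max

  below-four-D : (Δ : Diamond a y z z' w j) → ¬ (delay N d D (route Δ) ≡ D + D + D + D)
  below-four-D Δ slow =
    <⇒≢ (delay-< d<D (route-matched max Δ)) (trans slow (sym (sum-of-four D D D D)))

  never-four-D : (p : Path a j) → ¬ (delay N d D p ≡ D + D + D + D)
  never-four-D (ab ∷ be ∷ eh ∷ hj ∷ []) = below-four-D upper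
  never-four-D (ab ∷ bk ∷ kh ∷ hj ∷ []) = below-four-D (mirror upper)
  never-four-D (ac ∷ cf ∷ fi ∷ ij ∷ []) = below-four-D lower
  never-four-D (ac ∷ cg ∷ gi ∷ ij ∷ []) = below-four-D (mirror lower)

  one-matched-delay : (Δ : Diamond a y z z' w j) → OneMatched N (route Δ) →
                      delay N d D (route Δ) ≡ d + D + D + D
  one-matched-delay Δ one = trans (delay-one one) (sum-of-four d D D D)

  route-with-one-matched : Diamond a y z z' w j → N a y ≡ false →
                           ∃[ p ] (delay N d D {a} {j} p ≡ d + D + D + D)
  route-with-one-matched Δ off-ay =
    [ (λ one → route Δ , one-matched-delay Δ one)
    , (λ one → route (mirror Δ) , one-matched-delay (mirror Δ) one)
    ] (route-one-matched max Δ off-ay)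

  one-matched-route : ∃[ p ] (delay N d D {a} {j} p ≡ d + D + D + D)
  one-matched-route with N a b in ab-state
  ... | false = route-with-one-matched upper ab-state
  ... | true  = route-with-one-matched lower (partner-unique matching ab-state λ ())
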